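{- Let $D$ be a digraph on $n$ vertices and let $k\ge 2\delta^*_{\min}(D)+2$ be an integer. Then the diameter of ${\cal D}_k(D)$ is at most $(\delta^*_{\min}(D)+1)n$.
   Context: A $k$-dicolouring of a digraph $D$ is a map $V(D)\to\{1,\dots,k\}$ with no monochromatic directed cycle. ${\cal D}_k(D)$ is the graph whose vertices are the $k$-dicolourings of $D$, two adjacent if they differ on exactly one vertex. The min-degeneracy is $\delta^*_{\min}(D)=\max\{\min\{\delta^+(H),\delta^-(H)\} : H \text{ subdigraph of } D\}$. -}

module Defs where

open import Data.Nat using (ℕ; zero; suc; _+_; _*_; _≤_; _⊔_)
open import Data.Bool using (Bool; true; false; T)
open import Data.Fin using (Fin; zero; suc; inject₁; fromℕ)
open import Data.List using (List; length; filterᵇ; allFin)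
open import Data.Product using (Σ; ∃; _×_; _,_)
open import Data.Sum using (_⊎_)
open import Relation.Nullary using (¬_)
open import Relation.Binary.PropositionalEquality using (_≡_; _≢_)
open import Function.Definitions using (Injective)

-- A digraph on vertex set Fin n: a loopless arc relation (no parallel arcs;
-- digons u→v, v→u allowed).
record Digraph (n : ℕ) : Set where
  field
    arc      : Fin n → Fin n → Bool
    loopless : ∀ v → arc v v ≡ false
open Digraph public

-- A directed cycle of length m+1 in D: distinct vertices c 0, …, c m with
-- arcs c i → c (i+1) and c m → c 0.
record DirectedCycle {n : ℕ} (D : Digraph n) : Set where
  field
    len    : ℕ
    vert   : Fin (suc len) → Fin n
    inj    : Injective _≡_ _≡_ vert
    step   : ∀ (i : Fin len) → T (arc D (vert (inject₁ i)) (vert (suc i)))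
    close  : T (arc D (vert (fromℕ len)) (vert zero))
open DirectedCycle public

Colouring : ℕ → ℕ → Set
Colouring n k = Fin n → Fin k

IsDicolouring : ∀ {n} (D : Digraph n) (k : ℕ) → Colouring n k → Set
IsDicolouring D k φ = ¬ (Σ (DirectedCycle D) λ C →
  ∀ i j → φ (vert C i) ≡ φ (vert C j))

Adjacent : ∀ {n k} → Colouring n k → Colouring n k → Set
Adjacent {n} α β = Σ (Fin n) λ v → (α v ≢ β v) × (∀ u → u ≢ v → α u ≡ β u)

data Walk {n : ℕ} (D : Digraph n) (k : ℕ) :
     Colouring n k → Colouring n k → ℕ → Set where
  here : ∀ {α β} → IsDicolouring D k α → (∀ v → α v ≡ β v) → Walk D k α β zero
  next : ∀ {α γ β ℓ} → IsDicolouring D k α → Adjacent α γ →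
         Walk D k γ β ℓ → Walk D k α β (suc ℓ)

DistAtMost : ∀ {n} (D : Digraph n) (k : ℕ) → Colouring n k → Colouring n k → ℕ → Set
DistAtMost D k α β m = Σ ℕ λ ℓ → (ℓ ≤ m) × Walk D k α β ℓ

DiameterAtMost : ∀ {n} (D : Digraph n) (k : ℕ) → ℕ → Set
DiameterAtMost D k m = ∀ α β → IsDicolouring D k α → IsDicolouring D k β →
  DistAtMost D k α β m

record Subdigraph {n : ℕ} (D : Digraph n) : Set where
  field
    inV    : Fin n → Bool
    inA    : Fin n → Fin n → Bool
    arcSub : ∀ u v → T (inA u v) → T (arc D u v) × T (inV u) × T (inV v)
open Subdigraph public

outdeg : ∀ {n} {D : Digraph n} → Subdigraph D → Fin n → ℕ
outdeg {n} H v = length (filterᵇ (λ u → inA H v u) (allFin n))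

indeg : ∀ {n} {D : Digraph n} → Subdigraph D → Fin n → ℕ
indeg {n} H v = length (filterᵇ (λ u → inA H u v) (allFin n))

MinSemiDegAtLeast : ∀ {n} {D : Digraph n} → Subdigraph D → ℕ → Set
MinSemiDegAtLeast {n} H d = ∀ (v : Fin n) → T (inV H v) → d ≤ outdeg H v × d ≤ indeg H v

MinSemiDegAtMost : ∀ {n} {D : Digraph n} → Subdigraph D → ℕ → Set
MinSemiDegAtMost {n} H d = Σ (Fin n) λ v → T (inV H v) × (outdeg H v ≤ d ⊎ indeg H v ≤ d)

NonEmpty : ∀ {n} {D : Digraph n} → Subdigraph D → Set
NonEmpty {n} H = Σ (Fin n) λ v → T (inV H v)

-- d = δ*_min(D) = max over (nonempty) subdigraphs H of min(δ⁺(H), δ⁻(H));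
-- by convention 0 when D has no vertices.
IsMinDegeneracy : ∀ {n} (D : Digraph n) → ℕ → Set
IsMinDegeneracy D d =
  (∀ (H : Subdigraph D) → NonEmpty H → MinSemiDegAtMost H d) ×
  (d ≡ 0 ⊎ Σ (Subdigraph D) λ H → NonEmpty H × MinSemiDegAtLeast H d)

-- Every nonempty S ⊆ V(D) contains a vertex v with at most d out-neighbours (or at most
-- d in-neighbours) N in S, and v lies on no monochromatic cycle of S as long as its colour
-- differs from the colours of N.  So recolour S by induction on |S|: recolour S - v, and
-- insert moves of v into that sequence.  Whenever v has to move, it takes a colour
-- avoiding the current colours of N and the next d + 1 colours given to N (possible with
-- 2d + 2 colours), and is then safe for the next d + 1 moves at N.  If every vertex of
-- S - v moves at most d + 1 times, N moves at most d(d + 1) times, so v also moves at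
-- most d + 1 times.  Hence the recolouring of V(D) has length at most (d + 1) n.

module Submission where

open import Defs
open import Data.Bool using (Bool; true; false; T; _∧_; if_then_else_)
open import Data.Bool.Properties using (T-∧)
open import Data.Empty using (⊥-elim)
open import Data.Fin using (Fin; zero; suc; inject₁; fromℕ; _≟_)
open import Data.Fin.Properties using (any?; pigeonhole; <-irrefl)
open import Data.List using (List; []; _∷_; length; filterᵇ; allFin; lookup; map; take; _++_; foldl; scanl)
open import Data.List.Properties
  using (length-filter; length-tabulate; length-++; length-map; length-take; filter-all)
open import Data.List.Membership.Propositional using (_∈_; _∉_)
open import Data.List.Membership.Propositional.Properties
  using (∈-allFin; ∈-length; ∈-map⁺; ∈-++⁺ˡ; ∈-++⁺ʳ; ∈-filter⁺)
open import Data.List.Relation.Unary.All as All using (All; []; _∷_)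
open import Data.List.Relation.Unary.Any using (here; there; index)
open import Data.List.Relation.Unary.Any.Properties using (lookup-index)
open import Data.Nat using (ℕ; zero; suc; _+_; _*_; _∸_; _⊓_; _≤_; _<_; z≤n; s≤s)
open import Data.Nat.Properties hiding (_≟_; <-irrefl)
open import Data.Product using (∃; _×_; _,_; proj₁; proj₂)
open import Data.Sum using (_⊎_; inj₁; inj₂)
open import Data.Vec.Functional using (updateAt)
open import Data.Vec.Functional.Properties
  using (updateAt-updates; updateAt-minimal; updateAt-updateAt; updateAt-commutes; updateAt-id-local)
open import Function using (id; const; _∘_; case_of_)
open import Function.Bundles using (Equivalence)
open import Relation.Nullary using (¬_; yes; no; ¬?)
open import Relation.Nullary.Decidable using (T?; ⌊_⌋; decidable-stable)
open import Relation.Binary.PropositionalEquality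
  using (_≡_; _≢_; _≗_; refl; trans; sym; cong; cong₂; subst; ≢-sym; module ≡-Reasoning)

module _ {a} {A : Set a} {p q : A → Bool} (p⊆q : ∀ x → T (p x) → T (q x)) where

  private
    contradicts-p⊆q : ∀ {x} → p x ≡ true → q x ≡ false → ∀ {b} {B : Set b} → B
    contradicts-p⊆q {x} px qx = ⊥-elim (subst T qx (p⊆q x (subst T (sym px) _)))

  length-filterᵇ-mono : ∀ xs → length (filterᵇ p xs) ≤ length (filterᵇ q xs)
  length-filterᵇ-mono [] = ≤-refl
  length-filterᵇ-mono (x ∷ xs) with p x in px | q x in qx
  ... | true  | true  = s≤s (length-filterᵇ-mono xs)
  ... | true  | false = contradicts-p⊆q px qx
  ... | false | true  = m≤n⇒m≤1+n (length-filterᵇ-mono xs)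
  ... | false | false = length-filterᵇ-mono xs

  length-filterᵇ-< : ∀ {x xs} → x ∈ xs → T (q x) → ¬ T (p x) →
                     length (filterᵇ p xs) < length (filterᵇ q xs)
  length-filterᵇ-< {x} {_ ∷ xs} (here refl) qx ¬px with p x | q x
  ... | true  | _    = ⊥-elim (¬px _)
  ... | false | true = s≤s (length-filterᵇ-mono xs)
  length-filterᵇ-< {xs = y ∷ xs} (there x∈xs) qx ¬px with p y in py | q y in qy
  ... | true  | true  = s≤s (length-filterᵇ-< x∈xs qx ¬px)
  ... | true  | false = contradicts-p⊆q py qy
  ... | false | true  = m≤n⇒m≤1+n (length-filterᵇ-< x∈xs qx ¬px)
  ... | false | false = length-filterᵇ-< x∈xs qx ¬px

∸-+-< : ∀ {x y z} → x < z → y < z → x ∸ y + y < z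
∸-+-< {x} {y} {z} x<z y<z with ≤-total y x
... | inj₁ y≤x = subst (_< z) (sym (m∸n+n≡m y≤x)) x<z
... | inj₂ x≤y = subst (λ a → a + y < z) (sym (m≤n⇒m∸n≡0 x≤y)) y<z

2*d+2≡suc[d+suc[d]] : ∀ d → 2 * d + 2 ≡ suc (d + suc d)
2*d+2≡suc[d+suc[d]] d = begin
  2 * d + 2        ≡⟨ cong (λ x → d + x + 2) (+-identityʳ d) ⟩
  d + d + 2        ≡⟨ +-assoc d d 2 ⟩
  d + (d + 2)      ≡⟨ cong (d +_) (+-comm d 2) ⟩
  d + suc (suc d)  ≡⟨ +-suc d (suc d) ⟩
  suc (d + suc d)  ∎
  where open ≡-Reasoning

recolouring-step : ∀ d e j → j * suc d ≤ e + d ∸ d + suc d → suc j * suc d ≤ suc (e + d) + suc d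
recolouring-step d e j bound = begin
  suc d + j * suc d            ≤⟨ +-monoʳ-≤ (suc d) bound ⟩
  suc d + (e + d ∸ d + suc d)  ≡⟨ cong (λ x → suc d + (x + suc d)) (m+n∸n≡m e d) ⟩
  suc d + (e + suc d)          ≡⟨ +-comm (suc d) (e + suc d) ⟩
  e + suc d + suc d            ≡⟨ cong (_+ suc d) (+-suc e d) ⟩
  suc (e + d) + suc d          ∎
  where open ≤-Reasoning

recolourings-≤ : ∀ d e j → j * suc d ≤ e + d ∸ suc d + suc d → e ≤ d * suc d →
                 (d ≡ 0 → j ≡ 0) → j ≤ d
recolourings-≤ zero    e j _     _  j≡0 rewrite j≡0 refl = z≤n
recolourings-≤ (suc d) e j bound e≤ _ =
  ≤-pred (*-cancelʳ-< (suc (suc d)) j (suc (suc d))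
    (≤-<-trans bound (∸-+-< {y = suc (suc d)} e+d< (m<m+n _ (s≤s z≤n)))))
  where
  e+d< : e + suc d < suc (suc d) + suc d * suc (suc d)
  e+d< = begin-strict
    e + suc d                          ≤⟨ +-monoˡ-≤ (suc d) e≤ ⟩
    suc d * suc (suc d) + suc d        <⟨ +-monoʳ-< (suc d * suc (suc d)) (n<1+n (suc d)) ⟩
    suc d * suc (suc d) + suc (suc d)  ≡⟨ +-comm (suc d * suc (suc d)) (suc (suc d)) ⟩
    suc (suc d) + suc d * suc (suc d)  ∎
    where open ≤-Reasoning

VertexSet : ℕ → Set
VertexSet n = Fin n → Bool

module _ {n : ℕ} where

  _∖_ : VertexSet n → Fin n → VertexSet n
  (S ∖ v) u = if ⌊ u ≟ v ⌋ then false else S u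

  _∩_ : VertexSet n → VertexSet n → VertexSet n
  (P ∩ S) u = P u ∧ S u

  size : VertexSet n → ℕ
  size S = length (filterᵇ S (allFin n))

  module _ {S : VertexSet n} {v u : Fin n} where

    ∖-⊆ : T ((S ∖ v) u) → T (S u)
    ∖-⊆ t with u ≟ v
    ... | no _ = t

    ∖-≢ : T ((S ∖ v) u) → u ≢ v
    ∖-≢ t with u ≟ v
    ... | no u≢v = u≢v

    ∖-intro : T (S u) → u ≢ v → T ((S ∖ v) u)
    ∖-intro t u≢v with u ≟ v
    ... | yes u≡v = u≢v u≡v
    ... | no _    = t

  size-≤ : ∀ S → size S ≤ n
  size-≤ S = ≤-trans (length-filter _ (allFin n)) (≤-reflexive (length-tabulate id))

  size-mono : ∀ {P Q} → (∀ u → T (P u) → T (Q u)) → size P ≤ size Q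
  size-mono P⊆Q = length-filterᵇ-mono P⊆Q (allFin n)

  size-< : ∀ {P Q v} → (∀ u → T (P u) → T (Q u)) → T (Q v) → ¬ T (P v) → size P < size Q
  size-< {v = v} P⊆Q = length-filterᵇ-< P⊆Q (∈-allFin v)

  module _ {P S : VertexSet n} {v : Fin n} where

    ∩-∖-⊆ : ∀ u → T ((P ∩ (S ∖ v)) u) → T ((P ∩ S) u)
    ∩-∖-⊆ u t = let Pu , S∖v∋u = Equivalence.to T-∧ t
                in Equivalence.from T-∧ (Pu , ∖-⊆ {S = S} S∖v∋u)

    size-∩-∖-< : T (P v) → T (S v) → size (P ∩ (S ∖ v)) < size (P ∩ S)
    size-∩-∖-< Pv Sv = size-< ∩-∖-⊆ (Equivalence.from T-∧ (Pv , Sv))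
                         λ t → ∖-≢ {S = S} {v} {v} (proj₂ (Equivalence.to (T-∧ {P v}) t)) refl

  size-∖-< : ∀ {S v} → T (S v) → size (S ∖ v) < size S
  size-∖-< {S} {v} = size-∩-∖-< {P = const true} {S} {v} _

module _ {k : ℕ} where

  open import Data.List.Membership.DecPropositional (_≟_ {k}) using (_∈?_)

  short-list-misses : ∀ xs → length xs < k → ¬ (∀ c → c ∈ xs)
  short-list-misses xs short covers with pigeonhole short (λ c → index (covers c))
  ... | i , j , i<j , same = <-irrefl i≡j i<j
    where
    i≡j : i ≡ j
    i≡j = trans (lookup-index (covers i))
            (trans (cong (lookup xs) same) (sym (lookup-index (covers j))))

  fresh : Fin k → List (Fin k) → Fin k
  fresh c xs with c ∈? xs
  ... | no _ = c
  ... | yes _ with any? (λ c′ → ¬? (c′ ∈? xs))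
  ...   | yes (c′ , _) = c′
  ...   | no _         = c

  fresh-∉ : ∀ c xs → length xs < k → fresh c xs ∉ xs
  fresh-∉ c xs short with c ∈? xs
  ... | no c∉xs = c∉xs
  ... | yes _ with any? (λ c′ → ¬? (c′ ∈? xs))
  ...   | yes (_ , c′∉xs) = c′∉xs
  ...   | no none = ⊥-elim (short-list-misses xs short
                      (λ c′ → decidable-stable (c′ ∈? xs) (λ c′∉xs → none (c′ , c′∉xs))))

  fresh-prefers : ∀ {c xs} → c ∉ xs → fresh c xs ≡ c
  fresh-prefers {c} {xs} c∉xs with c ∈? xs
  ... | no _     = refl
  ... | yes c∈xs = ⊥-elim (c∉xs c∈xs)

last-or-inject₁ : ∀ {l} (i : Fin (suc l)) → i ≡ fromℕ l ⊎ ∃ λ j → i ≡ inject₁ j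
last-or-inject₁ {zero}  zero    = inj₁ refl
last-or-inject₁ {suc l} zero    = inj₂ (zero , refl)
last-or-inject₁ {suc l} (suc i) with last-or-inject₁ i
... | inj₁ i≡last    = inj₁ (cong suc i≡last)
... | inj₂ (j , i≡j) = inj₂ (suc j , cong suc i≡j)

module _ {n : ℕ} (D : Digraph n) where

  cycle-successor : (C : DirectedCycle D) (i : Fin (suc (len C))) →
                    ∃ λ j → T (arc D (vert C i) (vert C j))
  cycle-successor C i with last-or-inject₁ i
  ... | inj₁ refl       = zero , close C
  ... | inj₂ (j , refl) = suc j , step C j

  cycle-predecessor : (C : DirectedCycle D) (i : Fin (suc (len C))) →
                      ∃ λ j → T (arc D (vert C j) (vert C i))
  cycle-predecessor C zero    = fromℕ (len C) , close C
  cycle-predecessor C (suc i) = inject₁ i , step C i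

  arc-≢ : ∀ {u w} → T (arc D u w) → u ≢ w
  arc-≢ {u} a refl = subst T (loopless D u) a

  induced : VertexSet n → Subdigraph D
  induced S = record
    { inV    = S
    ; inA    = λ u w → S u ∧ (S w ∧ arc D u w)
    ; arcSub = λ u w uw → let Su , rest = Equivalence.to T-∧ uw
                              Sw , a    = Equivalence.to T-∧ rest
                          in a , Su , Sw
    }

  Within : VertexSet n → DirectedCycle D → Set
  Within S C = ∀ i → T (S (vert C i))

  Blocks : VertexSet n → Fin n → VertexSet n → Set
  Blocks S v N = ∀ C → Within S C → ∀ i → vert C i ≡ v → ∃ λ j → T (N (vert C j))

  small-semidegree-blocked : ∀ {d} S v → outdeg (induced S) v ≤ d ⊎ indeg (induced S) v ≤ d →
                             ∃ λ N → size N ≤ d × Blocks S v N × (∀ u → T (N u) → u ≢ v)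
  small-semidegree-blocked S v (inj₁ out-small) =
    inA (induced S) v , out-small , out-blocks , λ u → ≢-sym ∘ arc-≢ ∘ proj₁ ∘ arcSub (induced S) v u
    where
    out-blocks : Blocks S v (inA (induced S) v)
    out-blocks C within i refl = let j , a = cycle-successor C i in
      j , Equivalence.from T-∧ (within i , Equivalence.from T-∧ (within j , a))
  small-semidegree-blocked S v (inj₂ in-small) =
    (λ u → inA (induced S) u v) , in-small , in-blocks , λ u → arc-≢ ∘ proj₁ ∘ arcSub (induced S) u v
    where
    in-blocks : Blocks S v (λ u → inA (induced S) u v)
    in-blocks C within i refl = let j , a = cycle-predecessor C i in
      j , Equivalence.from T-∧ (within j , Equivalence.from T-∧ (within i , a))

module Dicolourings {n : ℕ} (D : Digraph n) (k : ℕ) where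

  AgreeOn : VertexSet n → Colouring n k → Colouring n k → Set
  AgreeOn S φ ψ = ∀ w → T (S w) → φ w ≡ ψ w

  Monochromatic : Colouring n k → DirectedCycle D → Set
  Monochromatic φ C = ∀ i j → φ (vert C i) ≡ φ (vert C j)

  record DicolouringOn (S : VertexSet n) (φ : Colouring n k) : Set where
    constructor dicolouringOn
    field no-monochromatic-cycle : ∀ C → Within D S C → ¬ Monochromatic φ C

  dicolouringOn-agree : ∀ {S φ ψ} → AgreeOn S φ ψ → DicolouringOn S φ → DicolouringOn S ψ
  dicolouringOn-agree φ≈ψ (dicolouringOn acyclic) = dicolouringOn λ C within mono →
    acyclic C within λ i j → trans (φ≈ψ _ (within i)) (trans (mono i j) (sym (φ≈ψ _ (within j))))

  dicolouringOn-∖ : ∀ {S v φ} → DicolouringOn S φ → DicolouringOn (S ∖ v) φ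
  dicolouringOn-∖ {S} (dicolouringOn acyclic) =
    dicolouringOn λ C within → acyclic C (λ i → ∖-⊆ {S = S} (within i))

  dicolouring⇒dicolouringOn : ∀ {S φ} → IsDicolouring D k φ → DicolouringOn S φ
  dicolouring⇒dicolouringOn dic = dicolouringOn λ C _ mono → dic (C , mono)

  dicolouringOn⇒dicolouring : ∀ {φ} → DicolouringOn (const true) φ → IsDicolouring D k φ
  dicolouringOn⇒dicolouring (dicolouringOn acyclic) (C , mono) = acyclic C _ mono

  dicolouring-cong : ∀ {α α′} → α ≗ α′ → IsDicolouring D k α′ → IsDicolouring D k α
  dicolouring-cong α≗α′ = dicolouringOn⇒dicolouring
                        ∘ dicolouringOn-agree (λ w _ → sym (α≗α′ w))
                        ∘ dicolouring⇒dicolouringOn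

  dicolouringOn-extend : ∀ {S v N φ} → Blocks D S v N → DicolouringOn (S ∖ v) φ →
                         (∀ u → T (N u) → φ u ≢ φ v) → DicolouringOn S φ
  dicolouringOn-extend {S} {v} blocks (dicolouringOn acyclic) separated =
    dicolouringOn λ C within mono → case any? (λ i → vert C i ≟ v) of λ where
      (yes (i , refl)) → let j , Nj = blocks C within i refl in separated (vert C j) Nj (mono j i)
      (no avoids)      → acyclic C (λ i → ∖-intro {S = S} (within i) (λ eq → avoids (i , eq))) mono

  Move : Set
  Move = Fin n × Fin k

  update : Colouring n k → Move → Colouring n k
  update φ (u , c) = updateAt φ u (const c)

  update-same : ∀ φ u c → update φ (u , c) u ≡ c
  update-same φ u c = updateAt-updates u φ

  update-other : ∀ φ {u} c {w} → w ≢ u → update φ (u , c) w ≡ φ w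
  update-other φ {u} c {w} = updateAt-minimal w u φ

  update-cong : ∀ {φ ψ} m → φ ≗ ψ → update φ m ≗ update ψ m
  update-cong {φ} {ψ} (u , c) φ≗ψ w with w ≟ u
  ... | yes refl = trans (update-same φ w c) (sym (update-same ψ w c))
  ... | no w≢u   = trans (update-other φ c w≢u) (trans (φ≗ψ w) (sym (update-other ψ c w≢u)))

  apply : Colouring n k → List Move → Colouring n k
  apply = foldl update

  apply-cong : ∀ {φ ψ} ms → φ ≗ ψ → apply φ ms ≗ apply ψ ms
  apply-cong []       φ≗ψ = φ≗ψ
  apply-cong (m ∷ ms) φ≗ψ = apply-cong ms (update-cong m φ≗ψ)

  ValidOn : VertexSet n → Colouring n k → List Move → Set
  ValidOn S φ ms = All (DicolouringOn S) (scanl update φ ms)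

  validOn-cong : ∀ {S φ ψ} ms → φ ≗ ψ → ValidOn S ψ ms → ValidOn S φ ms
  validOn-cong []       φ≗ψ (dic ∷ []) = dicolouringOn-agree (λ w _ → sym (φ≗ψ w)) dic ∷ []
  validOn-cong (m ∷ ms) φ≗ψ (dic ∷ valid) =
    dicolouringOn-agree (λ w _ → sym (φ≗ψ w)) dic ∷ validOn-cong ms (update-cong m φ≗ψ) valid

  Reconfigures : VertexSet n → Colouring n k → List Move → Colouring n k → Set
  Reconfigures S α ms β = ValidOn S α ms × AgreeOn S (apply α ms) β

  reconfigures-cong : ∀ {S α α′ β} ms → α ≗ α′ → Reconfigures S α′ ms β → Reconfigures S α ms β
  reconfigures-cong ms α≗α′ (valid , agree) =
    validOn-cong ms α≗α′ valid , λ w Sw → trans (apply-cong ms α≗α′ w) (agree w Sw)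

  reconfigures-∷ : ∀ {S α β m ms} → DicolouringOn S α → Reconfigures S (update α m) ms β →
                   Reconfigures S α (m ∷ ms) β
  reconfigures-∷ dic (valid , agree) = dic ∷ valid , agree

  walk-cong : ∀ {α α′ β ℓ} → α ≗ α′ → Walk D k α′ β ℓ → Walk D k α β ℓ
  walk-cong α≗α′ (here dic α′≗β) =
    here (dicolouring-cong α≗α′ dic) (λ w → trans (α≗α′ w) (α′≗β w))
  walk-cong α≗α′ (next dic (v , differ , agree) walk) =
    next (dicolouring-cong α≗α′ dic)
         (v , (λ eq → differ (trans (sym (α≗α′ v)) eq)) , λ w w≢v → trans (α≗α′ w) (agree w w≢v))
         walk

  reconfigures⇒walk : ∀ {α β} ms → Reconfigures (const true) α ms β →
                      ∃ λ ℓ → ℓ ≤ length ms × Walk D k α β ℓ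
  reconfigures⇒walk [] (dic ∷ [] , agree) =
    0 , z≤n , here (dicolouringOn⇒dicolouring dic) (λ w → agree w _)
  reconfigures⇒walk {α} ((u , c) ∷ ms) (dic ∷ valid , agree)
    with reconfigures⇒walk ms (valid , agree) | α u ≟ c
  ... | ℓ , ℓ≤ , walk | yes refl =
    ℓ , m≤n⇒m≤1+n ℓ≤ , walk-cong (sym ∘ updateAt-id-local u α refl) walk
  ... | ℓ , ℓ≤ , walk | no αu≢c =
    suc ℓ , s≤s ℓ≤ ,
    next (dicolouringOn⇒dicolouring dic)
         (u , (λ eq → αu≢c (trans eq (update-same α u c))) , λ w w≢u → sym (update-other α c w≢u))
         walk

  movesIn : VertexSet n → List Move → ℕ
  movesIn P ms = length (filterᵇ (P ∘ proj₁) ms)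

  MovesWithin : VertexSet n → List Move → Set
  MovesWithin S = All (λ (m : Move) → T (S (proj₁ m)))

  data Inserted (v : Fin n) : ℕ → List Move → List Move → Set where
    []     : Inserted v 0 [] []
    keep   : ∀ {j ms out} m → Inserted v j ms out → Inserted v j (m ∷ ms) (m ∷ out)
    insert : ∀ {j ms out} c → Inserted v j ms out → Inserted v (suc j) ms ((v , c) ∷ out)

  movesIn-inserted : ∀ {v j ms out} → Inserted v j ms out →
                     ∀ P → movesIn P out ≡ movesIn P ms + (if P v then j else 0)
  movesIn-inserted {v} [] P with P v
  ... | true  = refl
  ... | false = refl
  movesIn-inserted (keep (u , _) ins) P with P u
  ... | true  = cong suc (movesIn-inserted ins P)
  ... | false = movesIn-inserted ins P
  movesIn-inserted {v} (insert {j = j} {ms = ms} _ ins) P with P v | movesIn-inserted ins P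
  ... | true  | ih = trans (cong suc ih) (sym (+-suc (movesIn P ms) j))
  ... | false | ih = ih

  movesWithin-inserted : ∀ S {v j ms out} → T (S v) → Inserted v j ms out →
                         MovesWithin S ms → MovesWithin S out
  movesWithin-inserted S Sv []             []            = []
  movesWithin-inserted S Sv (keep m ins)   (Sm ∷ inside) = Sm ∷ movesWithin-inserted S Sv ins inside
  movesWithin-inserted S Sv (insert c ins) inside        = Sv ∷ movesWithin-inserted S Sv ins inside

  module Lift (d : ℕ) (S : VertexSet n) (v : Fin n) (N : VertexSet n) (β : Colouring n k) where

    neighbours : List (Fin n)
    neighbours = filterᵇ N (allFin n)

    targets : List Move → List (Fin k)
    targets ms = map proj₂ (filterᵇ (N ∘ proj₁) ms)

    forbidden : Colouring n k → List Move → List (Fin k)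
    forbidden ψ ms = map ψ neighbours ++ take (suc d) (targets ms)

    Separated : Colouring n k → Fin k → Set
    Separated ψ c = ∀ u → T (N u) → ψ u ≢ c

    finish : Fin k → List Move
    finish c with c ≟ β v
    ... | yes _ = []
    ... | no _  = (v , β v) ∷ []

    -- ms recolours S ∖ v from ψ; v currently has colour c, which avoids the next t colours
    -- given to N.  Before a move at N that c is not known to avoid, v is recoloured.
    lift : Colouring n k → Fin k → ℕ → List Move → List Move
    lift ψ c t [] = finish c
    lift ψ c t ((u , c′) ∷ ms) with N u
    lift ψ c t       ((u , c′) ∷ ms) | false = (u , c′) ∷ lift (update ψ (u , c′)) c t ms
    lift ψ c (suc t) ((u , c′) ∷ ms) | true  = (u , c′) ∷ lift (update ψ (u , c′)) c t ms
    lift ψ c zero    ((u , c′) ∷ ms) | true  =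
      (v , c*) ∷ (u , c′) ∷ lift (update ψ (u , c′)) c* d ms
      where c* = fresh c (forbidden ψ ((u , c′) ∷ ms))

    length-forbidden : ∀ ψ ms → length (forbidden ψ ms) ≡ size N + suc d ⊓ movesIn N ms
    length-forbidden ψ ms = begin
      length (map ψ neighbours ++ take (suc d) (targets ms))
        ≡⟨ length-++ (map ψ neighbours) ⟩
      length (map ψ neighbours) + length (take (suc d) (targets ms))
        ≡⟨ cong₂ _+_ (length-map ψ neighbours) (length-take (suc d) (targets ms)) ⟩
      size N + suc d ⊓ length (targets ms)
        ≡⟨ cong (λ l → size N + suc d ⊓ l) (length-map proj₂ (filterᵇ (N ∘ proj₁) ms)) ⟩
      size N + suc d ⊓ movesIn N ms
        ∎
      where open ≡-Reasoning

    targets-accept : ∀ {u c′ ms} → N u ≡ true → targets ((u , c′) ∷ ms) ≡ c′ ∷ targets ms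
    targets-accept N∋u rewrite N∋u = refl

    forbidden-current : ∀ {ψ ms c} → c ∉ forbidden ψ ms → Separated ψ c
    forbidden-current {ψ} c∉ u Nu refl =
      c∉ (∈-++⁺ˡ (∈-map⁺ ψ (∈-filter⁺ (T? ∘ N) (∈-allFin u) Nu)))

    forbidden-targets : ∀ {ψ ms c} → c ∉ forbidden ψ ms → c ∉ take (suc d) (targets ms)
    forbidden-targets {ψ} c∉ = c∉ ∘ ∈-++⁺ʳ (map ψ neighbours)

    separated-update : ∀ {ψ c u c′} → Separated ψ c → (T (N u) → c′ ≢ c) →
                       Separated (update ψ (u , c′)) c
    separated-update {ψ} {c} {u} {c′} separated new w Nw with w ≟ u
    ... | yes refl = new Nw ∘ trans (sym (update-same ψ w c′))
    ... | no w≢u   = separated w Nw ∘ trans (sym (update-other ψ c′ w≢u))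

    -- After the first t moves at N, one move of v is inserted per d + 1 moves at N,
    -- and possibly a final one.
    lift-inserts : ∀ ψ c t ms → ∃ λ j → Inserted v j ms (lift ψ c t ms)
                   × j * suc d ≤ movesIn N ms + d ∸ t + suc d
                   × (movesIn N ms ≡ 0 → c ≡ β v → j ≡ 0)
    lift-inserts ψ c t [] with c ≟ β v
    ... | yes _   = 0 , [] , z≤n , λ _ _ → refl
    ... | no c≢βv = 1 , insert (β v) [] ,
                    ≤-trans (≤-reflexive (+-identityʳ (suc d))) (m≤n+m (suc d) _) ,
                    λ _ c≡βv → ⊥-elim (c≢βv c≡βv)
    lift-inserts ψ c t ((u , c′) ∷ ms) with N u
    lift-inserts ψ c t ((u , c′) ∷ ms) | false =
      let j , ins , bound , quiet = lift-inserts (update ψ (u , c′)) c t ms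
      in j , keep (u , c′) ins , bound , quiet
    lift-inserts ψ c (suc t) ((u , c′) ∷ ms) | true =
      let j , ins , bound , _ = lift-inserts (update ψ (u , c′)) c t ms
      in j , keep (u , c′) ins , bound , λ ()
    lift-inserts ψ c zero ((u , c′) ∷ ms) | true =
      let j , ins , bound , _ =
            lift-inserts (update ψ (u , c′)) (fresh c (forbidden ψ ((u , c′) ∷ ms))) d ms
      in suc j , insert _ (keep (u , c′) ins) , recolouring-step d (movesIn N ms) j bound , λ ()

    module _ (N-small : size N ≤ d) (enough : d + suc d < k)
             (blocks : Blocks D S v N) (N∌v : ∀ u → T (N u) → u ≢ v)
             (dicβ : DicolouringOn S β) where

      fresh-allowed : ∀ c ψ ms → fresh c (forbidden ψ ms) ∉ forbidden ψ ms
      fresh-allowed c ψ ms = fresh-∉ c (forbidden ψ ms) (begin-strict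
        length (forbidden ψ ms)        ≡⟨ length-forbidden ψ ms ⟩
        size N + suc d ⊓ movesIn N ms  ≤⟨ +-mono-≤ N-small (m⊓n≤m (suc d) _) ⟩
        d + suc d                      <⟨ enough ⟩
        k                              ∎)
        where open ≤-Reasoning

      dicolouringOn-update : ∀ {ψ c} → DicolouringOn (S ∖ v) ψ → Separated ψ c →
                             DicolouringOn S (update ψ (v , c))
      dicolouringOn-update {ψ} {c} dic separated =
        dicolouringOn-extend blocks
          (dicolouringOn-agree (λ w S∖v∋w → sym (update-other ψ c (∖-≢ {S = S} S∖v∋w))) dic)
          λ u Nu eq → separated u Nu
            (trans (sym (update-other ψ c (N∌v u Nu))) (trans eq (update-same ψ v c)))

      update-agree : ∀ {ψ} → AgreeOn (S ∖ v) ψ β → AgreeOn S (update ψ (v , β v)) β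
      update-agree {ψ} agree w Sw with w ≟ v
      ... | yes refl = update-same ψ w (β w)
      ... | no w≢v   = trans (update-other ψ (β v) w≢v) (agree w (∖-intro {S = S} Sw w≢v))

      finish-reconfigures : ∀ {ψ c} → DicolouringOn (S ∖ v) ψ → AgreeOn (S ∖ v) ψ β →
                            Separated ψ c → Reconfigures S (update ψ (v , c)) (finish c) β
      finish-reconfigures {ψ} {c} dic agree separated with c ≟ β v
      ... | yes refl = dicolouringOn-update dic separated ∷ [] , update-agree agree
      ... | no _     = dicolouringOn-update dic separated
                     ∷ dicolouringOn-agree (λ w Sw → sym (reaches w Sw)) dicβ ∷ [] , reaches
        where
        reaches : AgreeOn S (update (update ψ (v , c)) (v , β v)) β
        reaches w Sw = trans (updateAt-updateAt v ψ w) (update-agree agree w Sw)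

      lift-reconfigures : ∀ ms ψ c t → Reconfigures (S ∖ v) ψ ms β → All (λ m → proj₁ m ≢ v) ms →
                          Separated ψ c → c ∉ take t (targets ms) →
                          Reconfigures S (update ψ (v , c)) (lift ψ c t ms) β
      lift-reconfigures [] ψ c t (dic ∷ [] , agree) [] separated _ =
        finish-reconfigures dic agree separated
      lift-reconfigures ((u , c′) ∷ ms) ψ c t (dic ∷ valid , agree) (u≢v ∷ avoid) separated c∉
        with N u in Nu
      ... | false =
        reconfigures-∷ (dicolouringOn-update dic separated)
          (reconfigures-cong _ (updateAt-commutes u v u≢v ψ)
            (lift-reconfigures ms (update ψ (u , c′)) c t (valid , agree) avoid
              (separated-update separated λ N∋u → ⊥-elim (subst T Nu N∋u)) c∉))
      lift-reconfigures ((u , c′) ∷ ms) ψ c (suc t) (dic ∷ valid , agree) (u≢v ∷ avoid) separated c∉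
        | true =
        reconfigures-∷ (dicolouringOn-update dic separated)
          (reconfigures-cong _ (updateAt-commutes u v u≢v ψ)
            (lift-reconfigures ms (update ψ (u , c′)) c t (valid , agree) avoid
              (separated-update separated λ _ c′≡c → c∉ (here (sym c′≡c))) (c∉ ∘ there)))
      lift-reconfigures ((u , c′) ∷ ms) ψ c zero (dic ∷ valid , agree) (u≢v ∷ avoid) separated _
        | true =
        reconfigures-∷ (dicolouringOn-update dic separated)
          (reconfigures-cong _ (updateAt-updateAt v ψ)
            (reconfigures-∷ (dicolouringOn-update dic separated*)
              (reconfigures-cong _ (updateAt-commutes u v u≢v ψ)
                (lift-reconfigures ms (update ψ (u , c′)) c* d (valid , agree) avoid
                  (separated-update separated* λ _ c′≡c* → c*∉targets (here (sym c′≡c*)))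
                  (c*∉targets ∘ there)))))
        where
        c* = fresh c (forbidden ψ ((u , c′) ∷ ms))
        c*∉ : c* ∉ forbidden ψ ((u , c′) ∷ ms)
        c*∉ = fresh-allowed c ψ ((u , c′) ∷ ms)
        separated* : Separated ψ c*
        separated* = forbidden-current c*∉
        c*∉targets : c* ∉ c′ ∷ take d (targets ms)
        c*∉targets = subst (λ ts → c* ∉ take (suc d) ts) (targets-accept Nu) (forbidden-targets c*∉)

  record Recolouring (r : ℕ) (S : VertexSet n) (α β : Colouring n k) : Set where
    field
      moves        : List Move
      within       : MovesWithin S moves
      reconfigures : Reconfigures S α moves β
      -- every vertex of S is recoloured at most r times
      sparse       : ∀ P → movesIn P moves ≤ r * size (P ∩ S)

  extend : ∀ {d S v N α β} → d + suc d < k → T (S v) → size N ≤ d → Blocks D S v N →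
           (∀ u → T (N u) → u ≢ v) → DicolouringOn S α → DicolouringOn S β →
           Recolouring (suc d) (S ∖ v) α β → Recolouring (suc d) S α β
  extend {d} {S} {v} {N} {α} {β} enough Sv N-small blocks N∌v dicα dicβ rec = record
    { moves        = lifted
    ; within       = movesWithin-inserted S Sv inserted (All.map (∖-⊆ {S = S}) within)
    ; reconfigures = reconfigures-∷ dicα
                       (lift-reconfigures N-small enough blocks N∌v dicβ moves α c₀ (suc d) reconfigures
                          (All.map (∖-≢ {S = S}) within)
                          (forbidden-current {α} {moves} c₀∉) (forbidden-targets {α} {moves} c₀∉))
    ; sparse       = sparse-lifted
    }
    where
    open Recolouring rec
    open Lift d S v N β

    c₀ = fresh (β v) (forbidden α moves)
    c₀∉ = fresh-allowed N-small enough blocks N∌v dicβ (β v) α moves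
    lifted = (v , c₀) ∷ lift α c₀ (suc d) moves

    counted = lift-inserts α c₀ (suc d) moves
    j = proj₁ counted

    inserted : Inserted v (suc j) moves lifted
    inserted = insert c₀ (proj₁ (proj₂ counted))

    E = movesIn N moves

    E≤ : E ≤ d * suc d
    E≤ = begin
      E                           ≤⟨ sparse N ⟩
      suc d * size (N ∩ (S ∖ v))  ≤⟨ *-monoʳ-≤ (suc d) (size-mono {P = N ∩ (S ∖ v)} {N}
                                                          (λ u → proj₁ ∘ Equivalence.to T-∧)) ⟩
      suc d * size N              ≤⟨ *-monoʳ-≤ (suc d) N-small ⟩
      suc d * d                   ≡⟨ *-comm (suc d) d ⟩
      d * suc d                   ∎
      where open ≤-Reasoning

    -- For d = 0 nothing is forbidden, so v goes straight to β v and never moves again.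
    one-move-if-d≡0 : d ≡ 0 → j ≡ 0
    one-move-if-d≡0 d≡0 = proj₂ (proj₂ (proj₂ counted)) E≡0 (fresh-prefers βv∉)
      where
      E≡0 : E ≡ 0
      E≡0 = n≤0⇒n≡0 (subst (λ x → E ≤ x * suc x) d≡0 E≤)
      βv∉ : β v ∉ forbidden α moves
      βv∉ βv∈ = n≮0 (<-≤-trans (∈-length βv∈) (begin
        length (forbidden α moves)  ≡⟨ length-forbidden α moves ⟩
        size N + suc d ⊓ E          ≤⟨ +-mono-≤ (subst (size N ≤_) d≡0 N-small)
                                                  (≤-reflexive (cong (suc d ⊓_) E≡0)) ⟩
        0                           ∎))
        where open ≤-Reasoning

    j≤d : j ≤ d
    j≤d = recolourings-≤ d E j (proj₁ (proj₂ (proj₂ counted))) E≤ one-move-if-d≡0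

    sparse-lifted : ∀ P → movesIn P lifted ≤ suc d * size (P ∩ S)
    sparse-lifted P with P v in Pv | movesIn-inserted inserted P
    ... | true | counts = begin
      _                                    ≡⟨ counts ⟩
      movesIn P moves + suc j              ≤⟨ +-mono-≤ (sparse P) (s≤s j≤d) ⟩
      suc d * size (P ∩ (S ∖ v)) + suc d   ≡⟨ +-comm (suc d * size (P ∩ (S ∖ v))) (suc d) ⟩
      suc d + suc d * size (P ∩ (S ∖ v))   ≡⟨ *-suc (suc d) (size (P ∩ (S ∖ v))) ⟨
      suc d * suc (size (P ∩ (S ∖ v)))     ≤⟨ *-monoʳ-≤ (suc d)
                                                (size-∩-∖-< {P = P} {S} {v} (subst T (sym Pv) _) Sv) ⟩
      suc d * size (P ∩ S)                 ∎
      where open ≤-Reasoning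
    ... | false | counts = begin
      _                                    ≡⟨ counts ⟩
      movesIn P moves + 0                  ≡⟨ +-identityʳ _ ⟩
      movesIn P moves                      ≤⟨ sparse P ⟩
      suc d * size (P ∩ (S ∖ v))           ≤⟨ *-monoʳ-≤ (suc d) (size-mono (∩-∖-⊆ {P = P} {S} {v})) ⟩
      suc d * size (P ∩ S)                 ∎
      where open ≤-Reasoning

  recolouring : ∀ {d} → IsMinDegeneracy D d → d + suc d < k →
                ∀ m S → size S ≤ m → ∀ {α β} → DicolouringOn S α → DicolouringOn S β →
                Recolouring (suc d) S α β
  recolouring min-degeneracy enough m S size≤m {α} dicα dicβ with any? (λ w → T? (S w))
  ... | no empty = record
    { moves        = []
    ; within       = []
    ; reconfigures = dicα ∷ [] , λ w Sw → ⊥-elim (empty (w , Sw))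
    ; sparse       = λ _ → z≤n
    }
  ... | yes nonempty with proj₁ min-degeneracy (induced D S) nonempty | m
  ...   | v , Sv , _     | zero = ⊥-elim (n≮0 (<-≤-trans (size-∖-< {S = S} Sv) size≤m))
  ...   | v , Sv , small | suc m =
    let N , N-small , blocks , N∌v = small-semidegree-blocked D S v small
        size≤m′ = ≤-pred (<-≤-trans (size-∖-< {S = S} Sv) size≤m)
    in extend enough Sv N-small blocks N∌v dicα dicβ
         (recolouring min-degeneracy enough m (S ∖ v) size≤m′ (dicolouringOn-∖ dicα) (dicolouringOn-∖ dicβ))

theorem9 : (n : ℕ) (D : Digraph n) (d k : ℕ) → IsMinDegeneracy D d →
    2 * d + 2 ≤ k → DiameterAtMost D k ((d + 1) * n)
theorem9 n D d k min-degeneracy 2d+2≤k α β dicα dicβ =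
  let ℓ , ℓ≤ , walk = reconfigures⇒walk moves reconfigures
  in ℓ , ≤-trans ℓ≤ length≤ , walk
  where
  open Dicolourings D k

  everything : VertexSet n
  everything _ = true

  enough : d + suc d < k
  enough = subst (_≤ k) (2*d+2≡suc[d+suc[d]] d) 2d+2≤k

  open Recolouring (recolouring min-degeneracy enough n everything (size-≤ everything)
                      (dicolouring⇒dicolouringOn {φ = α} dicα)
                      (dicolouring⇒dicolouringOn {φ = β} dicβ))

  length≤ : length moves ≤ (d + 1) * n
  length≤ = begin
    length moves              ≡⟨ cong length (filter-all (λ _ → T? true) (All.universal _ moves)) ⟨
    movesIn everything moves  ≤⟨ sparse everything ⟩
    suc d * size everything   ≤⟨ *-monoʳ-≤ (suc d) (size-≤ everything) ⟩
    suc d * n                 ≡⟨ cong (_* n) (+-comm 1 d) ⟩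
    (d + 1) * n               ∎
    where open ≤-Reasoning
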